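{- Let $u, v \in Q$ and let $m, n \ge 2$ be integers. Suppose $u^m = u_1 u_2$ and $v = u_1 c u_2$ for some words $u_1, u_2 \in V^*$ and some letter $c \in V$. Then $u^m v^n \in Q_{\overline{I}}$.
   Context: $V$ is a finite alphabet with at least two distinct letters; $V^*$ is the set of all finite words over $V$ (including the empty word). A nonempty word $w$ is primitive if it is not of the form $v^n$ for a word $v$ and an integer $n \ge 2$; $Q$ denotes the set of primitive words over $V$. For a word $w$ of length $n$, $w[1..i]$ denotes its prefix of length $i$ and $w[i+1..n]$ its suffix of length $n-i$. A primitive word $w$ of length $n$ is ins-robust if for every $i \in \{0,\ldots,n\}$ and every $a \in V$ the word $w[1..i]\,a\,w[i+1..n]$ is primitive. $Q_I$ is the set of ins-robust primitive words and $Q_{\overline{I}} = Q \setminus Q_I$ is the set of primitive words that are not ins-robust. -}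

module Defs where

open import Data.Nat using (ℕ; zero; suc; _≤_; _<_)
open import Data.Fin using (Fin)
open import Data.List using (List; []; _∷_; _++_; length; take; drop)
open import Data.Product using (Σ; ∃; _×_; _,_)
open import Relation.Nullary using (¬_)
open import Relation.Binary.PropositionalEquality using (_≡_)

-- The alphabet V is modelled as Fin k (a finite set with k letters);
-- the statement assumes 2 ≤ k (at least two distinct letters).
Word : ℕ → Set
Word k = List (Fin k)

_^ʷ_ : ∀ {k} → Word k → ℕ → Word k
w ^ʷ zero = []
w ^ʷ suc n = w ++ (w ^ʷ n)

Primitive : ∀ {k} → Word k → Set
Primitive {k} w = ¬ (w ≡ []) × ¬ (Σ (Word k) λ v → Σ ℕ λ n → (2 ≤ n) × (w ≡ v ^ʷ n))

insertAt : ∀ {k} → ℕ → Fin k → Word k → Word k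
insertAt i a w = take i w ++ (a ∷ drop i w)

InsRobust : ∀ {k} → Word k → Set
InsRobust {k} w = Primitive w × (∀ (i : ℕ) → i ≤ length w → (a : Fin k) → Primitive (insertAt i a w))

-- Q_Ī : primitive words that are not ins-robust
PrimNotInsRobust : ∀ {k} → Word k → Set
PrimNotInsRobust w = Primitive w × ¬ InsRobust w

module Submission where

-- Inserting c after u₁ turns u^m v^n into v^(n+1), so the word is not ins-robust. For primitivity
-- suppose u^m v^n = z^K with K ≥ 2, and put U = u^m, so that |v| = |U| + 1. If |z| + |v| ≤ |v^n|,
-- the periods |z| and |v| of v^n have a common divisor that is again a period (Fine–Wilf); v being
-- primitive, that period is |v|, so |v| divides |z| and hence |U|, impossible as 0 < |U| < |v|.
-- Otherwise K|z| = |U| + n|v| forces K = n = 2, |U| = 2p and |z| = 3p + 1. Then z z = U v v gives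
-- v = t₁ t₂ = y t₁ and U = t₂ y with |t₂| = |y| = p; since v is U with one letter inserted, U and v
-- share their first p or their last p letters, whence t₂ = y and v = t₁ t₂ = t₂ t₁ is not primitive.

open import Defs
open import Data.Fin using (Fin)
open import Data.Nat using (ℕ; zero; suc; _+_; _*_; _∸_; _≤_; _<_; z≤n; s≤s; >-nonZero)
open import Data.Nat.Properties
open import Data.Nat.Divisibility using (_∣_; divides; _∣0; ∣-refl; ∣-trans; ∣m∣n⇒∣m+n; ∣m+n∣m⇒∣n; n∣m*n; ∣⇒≤)
open import Data.Nat.Tactic.RingSolver using (solve-∀)
open import Data.List using (List; []; _∷_; _++_; length; take; drop; [_])
open import Data.List.Properties using (∷-injective; length-++; length-++-sucʳ; length-drop; length-++-≤ˡ; ++-conicalˡ; ++-assoc; ++-identityʳ; take++drop≡id)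
open import Data.Maybe using (Maybe; just; nothing)
open import Data.Maybe.Properties using (just-injective)
open import Data.Product using (∃; ∃₂; _×_; _,_; proj₂)
open import Data.Sum using (_⊎_; inj₁; inj₂)
open import Data.Empty using (⊥; ⊥-elim)
open import Relation.Nullary using (¬_; yes; no)
open import Relation.Binary.PropositionalEquality hiding ([_])
open import Function using (_∘_)

module _ {a} {A : Set a} where

  ++-equidivisible : ∀ (xs ys us vs : List A) → xs ++ ys ≡ us ++ vs → length xs ≤ length us →
                     ∃ λ t → us ≡ xs ++ t × ys ≡ t ++ vs
  ++-equidivisible []       ys us       vs eq _           = us , refl , eq
  ++-equidivisible (x ∷ xs) ys (u ∷ us) vs eq (s≤s xs≤us) with ∷-injective eq
  ... | refl , eq′ with ++-equidivisible xs ys us vs eq′ xs≤us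
  ... | t , us≡ , ys≡ = t , cong (x ∷_) us≡ , ys≡

  length-++-cancelˡ : ∀ (xs ys : List A) {m n} → length xs ≡ m → length (xs ++ ys) ≡ m + n → length ys ≡ n
  length-++-cancelˡ xs ys {m} refl eq = +-cancelˡ-≡ m _ _ (trans (sym (length-++ xs)) eq)

  length≡0⇒≡[] : ∀ (xs : List A) → length xs ≡ 0 → xs ≡ []
  length≡0⇒≡[] [] _ = refl

  0<length⇒≢[] : ∀ {xs : List A} → 0 < length xs → xs ≢ []
  0<length⇒≢[] {x ∷ xs} _ ()

  take-length-++ : ∀ (xs ys : List A) {n} → length xs ≡ n → take n (xs ++ ys) ≡ xs
  take-length-++ []       ys refl = refl
  take-length-++ (x ∷ xs) ys refl = cong (x ∷_) (take-length-++ xs ys refl)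

  drop-length-++ : ∀ (xs ys : List A) {n} → length xs ≡ n → drop n (xs ++ ys) ≡ ys
  drop-length-++ []       ys refl = refl
  drop-length-++ (x ∷ xs) ys refl = drop-length-++ xs ys refl

  insertion-keeps-prefix-or-suffix : ∀ n (xs ys : List A) y →
    take n (xs ++ y ∷ ys) ≡ take n (xs ++ ys) ⊎ drop (suc n) (xs ++ y ∷ ys) ≡ drop n (xs ++ ys)
  insertion-keeps-prefix-or-suffix n       []       ys y = inj₂ refl
  insertion-keeps-prefix-or-suffix zero    (x ∷ xs) ys y = inj₁ refl
  insertion-keeps-prefix-or-suffix (suc n) (x ∷ xs) ys y with insertion-keeps-prefix-or-suffix n xs ys y
  ... | inj₁ same-prefix = inj₁ (cong (x ∷_) same-prefix)
  ... | inj₂ same-suffix = inj₂ same-suffix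

  at : List A → ℕ → Maybe A
  at []       _       = nothing
  at (x ∷ xs) zero    = just x
  at (x ∷ xs) (suc i) = at xs i

  at-ext : ∀ (xs ys : List A) → (∀ i → at xs i ≡ at ys i) → xs ≡ ys
  at-ext []       []       _    = refl
  at-ext []       (y ∷ ys) same with same 0
  ... | ()
  at-ext (x ∷ xs) []       same with same 0
  ... | ()
  at-ext (x ∷ xs) (y ∷ ys) same = cong₂ _∷_ (just-injective (same 0)) (at-ext xs ys (same ∘ suc))

  at-++ˡ : ∀ (xs ys : List A) {i} → i < length xs → at (xs ++ ys) i ≡ at xs i
  at-++ˡ (x ∷ xs) ys {zero}  _         = refl
  at-++ˡ (x ∷ xs) ys {suc i} (s≤s i<n) = at-++ˡ xs ys i<n

  at-++ʳ : ∀ (xs ys : List A) i → at (xs ++ ys) (length xs + i) ≡ at ys i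
  at-++ʳ []       ys i = refl
  at-++ʳ (x ∷ xs) ys i = at-++ʳ xs ys i

  at-drop : ∀ n (xs : List A) i → at (drop n xs) i ≡ at xs (n + i)
  at-drop zero    xs       i = refl
  at-drop (suc n) []       i = refl
  at-drop (suc n) (x ∷ xs) i = at-drop n xs i

  at-take : ∀ n (xs : List A) {i} → i < n → at (take n xs) i ≡ at xs i
  at-take (suc n) []       _         = refl
  at-take (suc n) (x ∷ xs) {zero}  _ = refl
  at-take (suc n) (x ∷ xs) {suc i} (s≤s i<n) = at-take n xs i<n

  at-take-≥ : ∀ n (xs : List A) {i} → n ≤ i → at (take n xs) i ≡ nothing
  at-take-≥ zero    xs       _         = refl
  at-take-≥ (suc n) []       _         = refl
  at-take-≥ (suc n) (x ∷ xs) (s≤s n≤i) = at-take-≥ n xs n≤i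

  Period : List A → ℕ → Set a
  Period s d = ∀ i → i + d < length s → at s i ≡ at s (i + d)

  period-prefix : ∀ (s r : List A) {d} → Period (s ++ r) d → Period s d
  period-prefix s r {d} P i i+d<s = begin
    at s i              ≡⟨ sym (at-++ˡ s r (≤-<-trans (m≤m+n i d) i+d<s)) ⟩
    at (s ++ r) i       ≡⟨ P i (<-≤-trans i+d<s (subst (length s ≤_) (sym (length-++ s)) (m≤m+n _ _))) ⟩
    at (s ++ r) (i + d) ≡⟨ at-++ˡ s r i+d<s ⟩
    at s (i + d)        ∎
    where open ≡-Reasoning

  period-suffix : ∀ (r s : List A) {d} → Period (r ++ s) d → Period s d
  period-suffix r s {d} P i i+d<s = begin
    at s i                          ≡⟨ sym (at-++ʳ r s i) ⟩
    at (r ++ s) (length r + i)       ≡⟨ P (length r + i) fits ⟩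
    at (r ++ s) (length r + i + d)   ≡⟨ cong (at (r ++ s)) (+-assoc (length r) i d) ⟩
    at (r ++ s) (length r + (i + d)) ≡⟨ at-++ʳ r s (i + d) ⟩
    at s (i + d)                     ∎
    where
    open ≡-Reasoning
    fits : length r + i + d < length (r ++ s)
    fits = subst₂ _<_ (sym (+-assoc (length r) i d)) (sym (length-++ r)) (+-monoʳ-< (length r) i+d<s)

  period-difference : ∀ (s : List A) {d f} → Period s d → Period s (d + f) → d + (d + f) ≤ length s →
                      Period s f
  period-difference s {d} {f} Pd Pdf fits i i+f<s with i + (d + f) <? length s
  ... | yes i+[d+f]<s = begin
    at s i             ≡⟨ Pdf i i+[d+f]<s ⟩
    at s (i + (d + f)) ≡⟨ cong (at s) reassoc ⟩
    at s (i + f + d)   ≡⟨ sym (Pd (i + f) (subst (_< length s) reassoc i+[d+f]<s)) ⟩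
    at s (i + f)       ∎
    where
    open ≡-Reasoning
    reassoc : i + (d + f) ≡ i + f + d
    reassoc = trans (cong (i +_) (+-comm d f)) (sym (+-assoc i f d))
  ... | no i+[d+f]≮s = begin
    at s i             ≡⟨ cong (at s) (sym j+d≡i) ⟩
    at s (j + d)       ≡⟨ sym (Pd j (subst (_< length s) (sym j+d≡i) (≤-<-trans (m≤m+n i f) i+f<s))) ⟩
    at s j             ≡⟨ Pdf j (subst (_< length s) (sym j+[d+f]≡i+f) i+f<s) ⟩
    at s (j + (d + f)) ≡⟨ cong (at s) j+[d+f]≡i+f ⟩
    at s (i + f)       ∎
    where
    open ≡-Reasoning
    d≤i : d ≤ i
    d≤i = +-cancelʳ-≤ (d + f) d i (≤-trans fits (≮⇒≥ i+[d+f]≮s))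
    j : ℕ
    j = i ∸ d
    j+d≡i : j + d ≡ i
    j+d≡i = m∸n+n≡m d≤i
    j+[d+f]≡i+f : j + (d + f) ≡ i + f
    j+[d+f]≡i+f = trans (sym (+-assoc j d f)) (cong (_+ f) j+d≡i)

  period-common-divisor : ∀ (s : List A) {d e} → Period s d → Period s e → d + e ≤ length s →
                          ∃ λ g → Period s g × g ∣ d × g ∣ e
  period-common-divisor s {d} {e} = euclid (d + e) d e ≤-refl
    where
    CommonPeriod : ℕ → ℕ → Set a
    CommonPeriod d e = ∃ λ g → Period s g × g ∣ d × g ∣ e

    swap : ∀ {d e} → CommonPeriod d e → CommonPeriod e d
    swap (g , Pg , g∣d , g∣e) = g , Pg , g∣e , g∣d

    euclid : ∀ n d e → d + e ≤ n → Period s d → Period s e → d + e ≤ length s → CommonPeriod d e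
    subtract : ∀ n d f → suc d + (suc d + f) ≤ suc n → Period s (suc d) → Period s (suc d + f) →
               suc d + (suc d + f) ≤ length s → CommonPeriod (suc d) (suc d + f)

    euclid _       zero    e       _  _  Pe _ = e , Pe , e ∣0 , ∣-refl
    euclid _       (suc d) zero    _  Pd _  _ = suc d , Pd , ∣-refl , suc d ∣0
    euclid zero    (suc d) (suc e) ()
    euclid (suc n) (suc d) (suc e) bound Pd Pe fits with suc d ≤? suc e
    ... | yes d≤e with m≤n⇒∃[o]m+o≡n d≤e
    ...   | f , refl = subtract n d f bound Pd Pe fits
    euclid (suc n) (suc d) (suc e) bound Pd Pe fits | no d≰e with m≤n⇒∃[o]m+o≡n (<⇒≤ (≰⇒> d≰e))
    ...   | f , refl = swap (subtract n e f (subst (_≤ suc n) (+-comm _ (suc e)) bound) Pe Pd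
                                          (subst (_≤ length s) (+-comm _ (suc e)) fits))

    subtract n d f bound Pd Pdf fits
      with euclid n (suc d) f (≤-trans (m≤n+m _ d) (≤-pred bound)) Pd (period-difference s Pd Pdf fits)
                  (≤-trans (m≤n+m _ (suc d)) fits)
    ... | g , Pg , g∣d , g∣f = g , Pg , g∣d , ∣m∣n⇒∣m+n g∣d g∣f

  period-drop : ∀ (x : List A) {g} → Period x g → Period (drop g x) g
  period-drop x {g} P =
    period-suffix (take g x) (drop g x) (subst (λ w → Period w g) (sym (take++drop≡id g x)) P)

  take-drop-period : ∀ (x : List A) {g} → Period x g → g + g ≤ length x → take g (drop g x) ≡ take g x
  take-drop-period x {g} P fits = at-ext _ _ same
    where
    open ≡-Reasoning
    same : ∀ i → at (take g (drop g x)) i ≡ at (take g x) i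
    same i with i <? g
    ... | yes i<g = begin
      at (take g (drop g x)) i ≡⟨ at-take g (drop g x) i<g ⟩
      at (drop g x) i          ≡⟨ at-drop g x i ⟩
      at x (g + i)             ≡⟨ cong (at x) (+-comm g i) ⟩
      at x (i + g)             ≡⟨ sym (P i (<-≤-trans (+-monoˡ-< g i<g) fits)) ⟩
      at x i                   ≡⟨ sym (at-take g x i<g) ⟩
      at (take g x) i          ∎
    ... | no i≮g = trans (at-take-≥ g _ (≮⇒≥ i≮g)) (sym (at-take-≥ g x (≮⇒≥ i≮g)))

module _ {k : ℕ} where

  ^ʷ-+ : ∀ (w : Word k) m n → w ^ʷ (m + n) ≡ w ^ʷ m ++ w ^ʷ n
  ^ʷ-+ w zero    n = refl
  ^ʷ-+ w (suc m) n = trans (cong (w ++_) (^ʷ-+ w m n)) (sym (++-assoc w _ _))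

  ^ʷ-suc : ∀ (w : Word k) n → w ^ʷ suc n ≡ w ^ʷ n ++ w
  ^ʷ-suc w n = begin
    w ^ʷ suc n        ≡⟨ cong (w ^ʷ_) (+-comm 1 n) ⟩
    w ^ʷ (n + 1)      ≡⟨ ^ʷ-+ w n 1 ⟩
    w ^ʷ n ++ w ++ [] ≡⟨ cong (w ^ʷ n ++_) (++-identityʳ w) ⟩
    w ^ʷ n ++ w       ∎
    where open ≡-Reasoning

  length-^ʷ : ∀ (w : Word k) n → length (w ^ʷ n) ≡ n * length w
  length-^ʷ w zero    = refl
  length-^ʷ w (suc n) = trans (length-++ w) (cong (length w +_) (length-^ʷ w n))

  0<length-^ʷ : ∀ (w : Word k) n → w ≢ [] → 0 < length (w ^ʷ suc n)
  0<length-^ʷ []      _ w≢[] = ⊥-elim (w≢[] refl)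
  0<length-^ʷ (_ ∷ _) _ _    = s≤s z≤n

  power-period : ∀ (w : Word k) n → Period (w ^ʷ n) (length w)
  power-period w zero    i ()
  power-period w (suc n) i fits = begin
    at (w ^ʷ suc n) i               ≡⟨ cong (λ x → at x i) (^ʷ-suc w n) ⟩
    at (w ^ʷ n ++ w) i              ≡⟨ at-++ˡ (w ^ʷ n) w i<|wⁿ| ⟩
    at (w ^ʷ n) i                   ≡⟨ sym (at-++ʳ w (w ^ʷ n) i) ⟩
    at (w ^ʷ suc n) (length w + i)  ≡⟨ cong (at (w ^ʷ suc n)) (+-comm (length w) i) ⟩
    at (w ^ʷ suc n) (i + length w)  ∎
    where
    open ≡-Reasoning
    i<|wⁿ| : i < length (w ^ʷ n)
    i<|wⁿ| = +-cancelˡ-< (length w) i _ (subst₂ _<_ (+-comm i (length w)) (length-++ w) fits)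

  periodic⇒power : ∀ j (x : Word k) {g} → Period x g → length x ≡ j * g → x ≡ take g x ^ʷ j
  periodic⇒power zero    x       P |x|≡0 = length≡0⇒≡[] x |x|≡0
  periodic⇒power (suc j) x {g} P |x|≡[1+j]g = begin
    x                                  ≡⟨ sym (take++drop≡id g x) ⟩
    take g x ++ drop g x               ≡⟨ cong (take g x ++_) (periodic⇒power j (drop g x) (period-drop x P) |drop|) ⟩
    take g x ++ take g (drop g x) ^ʷ j ≡⟨ cong (take g x ++_) (same-root j |x|≡[1+j]g) ⟩
    take g x ++ take g x ^ʷ j          ∎
    where
    open ≡-Reasoning
    |drop| : length (drop g x) ≡ j * g
    |drop| = trans (length-drop g x) (trans (cong (_∸ g) |x|≡[1+j]g) (m+n∸m≡n g (j * g)))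
    same-root : ∀ j → length x ≡ suc j * g → take g (drop g x) ^ʷ j ≡ take g x ^ʷ j
    same-root zero    _   = refl
    same-root (suc j) |x| =
      cong (_^ʷ suc j) (take-drop-period x P (subst (g + g ≤_) (sym |x|) (+-monoʳ-≤ g (m≤m+n g (j * g)))))

  commuting⇒common-root : ∀ (x y : Word k) → x ++ y ≡ y ++ x →
                          ∃ λ r → ∃₂ λ i j → x ≡ r ^ʷ i × y ≡ r ^ʷ j
  commuting⇒common-root x y = go (length x + length y) x y ≤-refl
    where
    CommonRoot : Word k → Word k → Set
    CommonRoot x y = ∃ λ r → ∃₂ λ i j → x ≡ r ^ʷ i × y ≡ r ^ʷ j

    swap : ∀ {x y} → CommonRoot x y → CommonRoot y x
    swap (r , i , j , x≡rⁱ , y≡rʲ) = r , j , i , y≡rʲ , x≡rⁱ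

    go : ∀ n (x y : Word k) → length x + length y ≤ n → x ++ y ≡ y ++ x → CommonRoot x y
    peel : ∀ n (x y : Word k) → 0 < length x → length x ≤ length y → length x + length y ≤ suc n →
           x ++ y ≡ y ++ x → CommonRoot x y

    go _       []         y          _     _     = y , 0 , 1 , refl , sym (++-identityʳ y)
    go _       x@(_ ∷ _)  []         _     _     = x , 1 , 0 , sym (++-identityʳ x) , refl
    go zero    (_ ∷ _)    (_ ∷ _)    ()
    go (suc n) x@(_ ∷ _)  y@(_ ∷ _)  bound xy≡yx with length x ≤? length y
    ... | yes x≤y = peel n x y (s≤s z≤n) x≤y bound xy≡yx
    ... | no  x≰y = swap (peel n y x (s≤s z≤n) (<⇒≤ (≰⇒> x≰y))
                                (subst (_≤ suc n) (+-comm (length x) (length y)) bound) (sym xy≡yx))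

    peel n x y 0<|x| x≤y bound xy≡yx with ++-equidivisible x y y x xy≡yx x≤y
    ... | t , y≡xt , y≡tx with go n x t shorter (trans (sym y≡xt) y≡tx)
      where
      |y|≡|x|+|t| : length y ≡ length x + length t
      |y|≡|x|+|t| = trans (cong length y≡xt) (length-++ x)
      shorter : length x + length t ≤ n
      shorter = ≤-pred (≤-trans (subst (_< length x + length y) |y|≡|x|+|t| (m<n+m (length y) 0<|x|)) bound)
    ... | r , i , j , x≡rⁱ , t≡rʲ =
      r , i , i + j , x≡rⁱ , trans y≡xt (trans (cong₂ _++_ x≡rⁱ t≡rʲ) (sym (^ʷ-+ r i j)))

  commuting⇒¬primitive : ∀ {x y : Word k} → x ≢ [] → y ≢ [] → x ++ y ≡ y ++ x → ¬ Primitive (x ++ y)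
  commuting⇒¬primitive {x} {y} x≢[] y≢[] xy≡yx (_ , not-power) with commuting⇒common-root x y xy≡yx
  ... | r , zero  , _     , x≡[] , _    = x≢[] x≡[]
  ... | r , suc _ , zero  , _    , y≡[] = y≢[] y≡[]
  ... | r , suc i , suc j , x≡rⁱ , y≡rʲ =
    not-power (r , suc i + suc j , s≤s (≤-trans (s≤s z≤n) (m≤n+m (suc j) i)) ,
               trans (cong₂ _++_ x≡rⁱ y≡rʲ) (sym (^ʷ-+ r (suc i) (suc j))))

  primitive-period∣length⇒≡length : ∀ {v : Word k} {g} → Primitive v → Period v g → g ∣ length v →
                                    g ≡ length v
  primitive-period∣length⇒≡length {v} (v≢[] , _) _ (divides zero |v|≡0) = ⊥-elim (v≢[] (length≡0⇒≡[] v |v|≡0))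
  primitive-period∣length⇒≡length {g = g} _ _ (divides 1 |v|≡g+0) = sym (trans |v|≡g+0 (+-identityʳ g))
  primitive-period∣length⇒≡length {v} {g} (_ , not-power) P (divides (suc (suc q)) |v|≡[2+q]g) =
    ⊥-elim (not-power (take g v , suc (suc q) , s≤s (s≤s z≤n) , periodic⇒power (suc (suc q)) v P |v|≡[2+q]g))

  no-short-root : ∀ (U v z : Word k) n K → Primitive v → 0 < length U → length v ≡ suc (length U) →
                  U ++ v ^ʷ suc n ≡ z ^ʷ K → length z + length v ≤ length (v ^ʷ suc n) → ⊥
  no-short-root U v z n K pv 0<|U| |v|≡1+|U| w≡zᴷ fits
    with period-common-divisor (v ^ʷ suc n)
           (period-suffix U _ (subst (λ w → Period w (length z)) (sym w≡zᴷ) (power-period z K)))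
           (power-period v (suc n)) fits
  ... | g , Pg , g∣|z| , g∣|v| with primitive-period∣length⇒≡length pv (period-prefix v (v ^ʷ n) Pg) g∣|v|
  ... | refl = 1+n≰n (subst (_≤ length U) |v|≡1+|U| (∣⇒≤ {{>-nonZero 0<|U|}} |v|∣|U|))
    where
    open ≡-Reasoning
    lengths : K * length z ≡ suc n * length v + length U
    lengths = begin
      K * length z                       ≡⟨ sym (length-^ʷ z K) ⟩
      length (z ^ʷ K)                    ≡⟨ cong length (sym w≡zᴷ) ⟩
      length (U ++ v ^ʷ suc n)           ≡⟨ length-++ U ⟩
      length U + length (v ^ʷ suc n)     ≡⟨ cong (length U +_) (length-^ʷ v (suc n)) ⟩
      length U + suc n * length v        ≡⟨ +-comm (length U) _ ⟩
      suc n * length v + length U        ∎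
    |v|∣|U| : length v ∣ length U
    |v|∣|U| = ∣m+n∣m⇒∣n (subst (length v ∣_) lengths (∣-trans g∣|z| (n∣m*n K))) (n∣m*n (suc n))

long-root-exponents : ∀ L Z a b → (2 + b) * Z ≡ L + (2 + a) * suc L → (2 + a) * suc L < Z + suc L →
                      a ≡ 0 × b ≡ 0
long-root-exponents L Z a b eq long =
  exponents a b eq (+-cancelˡ-< (suc L) _ Z (subst ((2 + a) * suc L <_) (+-comm Z (suc L)) long))
  where
  open ≤-Reasoning
  M : ℕ
  M = suc L
  exponents : ∀ a b → (2 + b) * Z ≡ L + (2 + a) * M → (1 + a) * M < Z → a ≡ 0 × b ≡ 0
  exponents zero    zero    _  _   = refl , refl
  exponents (suc a) b       eq [2+a]M<Z = ⊥-elim (<-irrefl (sym eq) (begin-strict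
    L + (3 + a) * M            <⟨ +-monoˡ-< _ (n<1+n L) ⟩
    M + (M + (2 + a) * M)      ≡⟨ sym (+-assoc M M _) ⟩
    (M + M) + (2 + a) * M      ≤⟨ +-monoˡ-≤ _ (+-monoʳ-≤ M (m≤m+n M (a * M))) ⟩
    (2 + a) * M + (2 + a) * M  <⟨ +-mono-< [2+a]M<Z [2+a]M<Z ⟩
    Z + Z                      ≤⟨ +-monoʳ-≤ Z (m≤m+n Z (b * Z)) ⟩
    (2 + b) * Z                ∎))
  exponents zero    (suc b) eq M+0<Z = ⊥-elim (<-irrefl (sym eq) (begin-strict
    L + 2 * M                  <⟨ +-monoˡ-< _ (n<1+n L) ⟩
    M + (M + (M + 0))          <⟨ +-mono-< M<Z (+-mono-< M<Z M+0<Z) ⟩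
    Z + (Z + Z)                ≤⟨ +-monoʳ-≤ Z (+-monoʳ-≤ Z (m≤m+n Z (b * Z))) ⟩
    (3 + b) * Z                ∎))
    where
    M<Z : M < Z
    M<Z = subst (_< Z) (+-identityʳ M) M+0<Z

square-root-lengths : ∀ L Z → 2 * Z ≡ L + 2 * suc L → ∃ λ p → L ≡ p + p × Z ≡ suc (p + (p + p))
square-root-lengths L Z eq with suc L ≤? Z
... | no Z≯L = ⊥-elim (<-irrefl eq (begin-strict
  2 * Z          ≤⟨ *-monoʳ-≤ 2 (≤-pred (≰⇒> Z≯L)) ⟩
  2 * L          <⟨ *-monoʳ-< 2 (n<1+n L) ⟩
  2 * suc L      ≤⟨ m≤n+m _ L ⟩
  L + 2 * suc L  ∎))
  where open ≤-Reasoning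
... | yes L<Z with m≤n⇒∃[o]m+o≡n L<Z
... | p , refl = p , L≡p+p , trans (cong (λ l → suc l + p) L≡p+p) (cong suc (+-assoc p p p))
  where
  2[1+L+p]≡2+2L+2p : ∀ L p → 2 * (suc L + p) ≡ (2 + L + L) + (p + p)
  2[1+L+p]≡2+2L+2p = solve-∀
  L+2[1+L]≡2+2L+L : ∀ L → L + 2 * suc L ≡ (2 + L + L) + L
  L+2[1+L]≡2+2L+L = solve-∀
  L≡p+p : L ≡ p + p
  L≡p+p = sym (+-cancelˡ-≡ (2 + L + L) _ _ (trans (sym (2[1+L+p]≡2+2L+2p L p)) (trans eq (L+2[1+L]≡2+2L+L L))))

module _ {a} {A : Set a} where

  private
    3p+1≡2p+[p+1] : ∀ p → suc (p + (p + p)) ≡ (p + p) + suc p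
    3p+1≡2p+[p+1] = solve-∀

  square-factorisation : ∀ (z U v : List A) p → length U ≡ p + p → length v ≡ suc (p + p) →
    length z ≡ suc (p + (p + p)) → z ++ z ≡ U ++ (v ++ v) →
    ∃₂ λ t₁ t₂ → ∃ λ y → v ≡ t₁ ++ t₂ × v ≡ y ++ t₁ × U ≡ t₂ ++ y ×
                          length t₁ ≡ suc p × length t₂ ≡ p × length y ≡ p
  square-factorisation z U v p lU lv lz zz
    with ++-equidivisible U (v ++ v) z z (sym zz) (subst₂ _≤_ (sym lU) (sym lz) (≤-trans (+-monoʳ-≤ p (m≤m+n p p)) (n≤1+n _)))
  ... | t₁ , z≡Ut₁ , vv≡t₁z
    with length-++-cancelˡ U t₁ lU (trans (cong length (sym z≡Ut₁)) (trans lz (3p+1≡2p+[p+1] p)))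
  ... | lt₁
    with ++-equidivisible t₁ z v v (sym vv≡t₁z) (subst₂ _≤_ (sym lt₁) (sym lv) (s≤s (m≤m+n p p)))
  ... | t₂ , v≡t₁t₂ , z≡t₂v
    with length-++-cancelˡ t₁ t₂ lt₁ (trans (cong length (sym v≡t₁t₂)) lv)
  ... | lt₂
    with ++-equidivisible t₂ v U t₁ (trans (sym z≡t₂v) z≡Ut₁) (subst₂ _≤_ (sym lt₂) (sym lU) (m≤m+n p p))
  ... | y , U≡t₂y , v≡yt₁ =
    t₁ , t₂ , y , v≡t₁t₂ , v≡yt₁ , U≡t₂y , lt₁ , lt₂ , length-++-cancelˡ t₂ y lt₂ (trans (cong length (sym U≡t₂y)) lU)

module Insertion {k : ℕ} (u₁ u₂ : Word k) (c : Fin k) where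

  U : Word k
  U = u₁ ++ u₂

  v : Word k
  v = u₁ ++ c ∷ u₂

  |v|≡1+|U| : length v ≡ suc (length U)
  |v|≡1+|U| = length-++-sucʳ u₁ c u₂

  root-lengths : ∀ n K (z : Word k) → U ++ v ^ʷ n ≡ z ^ʷ K → K * length z ≡ length U + n * suc (length U)
  root-lengths n K z w≡zᴷ = begin
    K * length z                ≡⟨ sym (length-^ʷ z K) ⟩
    length (z ^ʷ K)             ≡⟨ cong length (sym w≡zᴷ) ⟩
    length (U ++ v ^ʷ n)        ≡⟨ length-++ U ⟩
    length U + length (v ^ʷ n)  ≡⟨ cong (length U +_) (length-^ʷ v n) ⟩
    length U + n * length v     ≡⟨ cong (λ m → length U + n * m) |v|≡1+|U| ⟩
    length U + n * suc (length U) ∎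
    where open ≡-Reasoning

  no-square-root : ∀ (z : Word k) → 0 < length U → U ++ v ^ʷ 2 ≡ z ^ʷ 2 → ¬ Primitive v
  no-square-root z 0<|U| w≡z² with square-root-lengths (length U) (length z) (root-lengths 2 2 z w≡z²)
  ... | p , |U|≡p+p , |z|≡3p+1
    with square-factorisation z U v p |U|≡p+p (trans |v|≡1+|U| (cong suc |U|≡p+p)) |z|≡3p+1 zz≡Uvv
    where
    zz≡Uvv : z ++ z ≡ U ++ (v ++ v)
    zz≡Uvv = begin
      z ++ z          ≡⟨ cong (z ++_) (sym (++-identityʳ z)) ⟩
      z ^ʷ 2          ≡⟨ sym w≡z² ⟩
      U ++ v ^ʷ 2     ≡⟨ cong (λ x → U ++ v ++ x) (++-identityʳ v) ⟩
      U ++ (v ++ v)   ∎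
      where open ≡-Reasoning
  ... | t₁ , t₂ , y , v≡t₁t₂ , v≡yt₁ , U≡t₂y , |t₁| , |t₂| , |y| =
    subst (¬_ ∘ Primitive) (sym v≡t₁t₂)
      (commuting⇒¬primitive t₁≢[] t₂≢[] (trans (sym v≡t₁t₂) (trans v≡yt₁ (cong (_++ t₁) (sym t₂≡y)))))
    where
    open ≡-Reasoning
    0<p : 0 < p
    0<p = half-positive p (subst (0 <_) |U|≡p+p 0<|U|)
      where
      half-positive : ∀ q → 0 < q + q → 0 < q
      half-positive (suc _) _ = s≤s z≤n
    t₁≢[] : t₁ ≢ []
    t₁≢[] = 0<length⇒≢[] (subst (0 <_) (sym |t₁|) (s≤s z≤n))
    t₂≢[] : t₂ ≢ []
    t₂≢[] = 0<length⇒≢[] (subst (0 <_) (sym |t₂|) 0<p)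
    t₂≡y : t₂ ≡ y
    t₂≡y with insertion-keeps-prefix-or-suffix p u₁ u₂ c
    ... | inj₁ same-prefix = begin
      t₂                ≡⟨ sym (take-length-++ t₂ y |t₂|) ⟩
      take p (t₂ ++ y)  ≡⟨ cong (take p) (sym U≡t₂y) ⟩
      take p U          ≡⟨ sym same-prefix ⟩
      take p v          ≡⟨ cong (take p) v≡yt₁ ⟩
      take p (y ++ t₁)  ≡⟨ take-length-++ y t₁ |y| ⟩
      y                 ∎
    ... | inj₂ same-suffix = begin
      t₂                        ≡⟨ sym (drop-length-++ t₁ t₂ |t₁|) ⟩
      drop (suc p) (t₁ ++ t₂)   ≡⟨ cong (drop (suc p)) (sym v≡t₁t₂) ⟩
      drop (suc p) v            ≡⟨ same-suffix ⟩
      drop p U                  ≡⟨ cong (drop p) U≡t₂y ⟩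
      drop p (t₂ ++ y)          ≡⟨ drop-length-++ t₂ y |t₂| ⟩
      y                         ∎

  U++vⁿ-primitive : Primitive v → 0 < length U → ∀ n → Primitive (U ++ v ^ʷ suc (suc n))
  U++vⁿ-primitive pv 0<|U| n = U++vⁿ≢[] , no-root
    where
    U++vⁿ≢[] : U ++ v ^ʷ suc (suc n) ≢ []
    U++vⁿ≢[] w≡[] = 0<length⇒≢[] 0<|U| (++-conicalˡ U _ w≡[])
    no-root : ¬ (∃ λ z → ∃ λ K → 2 ≤ K × U ++ v ^ʷ suc (suc n) ≡ z ^ʷ K)
    no-root (z , suc (suc K) , s≤s (s≤s _) , w≡zᴷ) with length z + length v ≤? length (v ^ʷ suc (suc n))
    ... | yes fits = no-short-root U v z (suc n) (suc (suc K)) pv 0<|U| |v|≡1+|U| w≡zᴷ fits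
    ... | no long
      with long-root-exponents (length U) (length z) n K (root-lengths (suc (suc n)) (suc (suc K)) z w≡zᴷ)
             (subst₂ _<_ (trans (length-^ʷ v (suc (suc n))) (cong (suc (suc n) *_) |v|≡1+|U|))
                         (cong (length z +_) |v|≡1+|U|) (≰⇒> long))
    ... | refl , refl = no-square-root z 0<|U| w≡zᴷ pv

  U++vⁿ-not-ins-robust : ∀ n → ¬ InsRobust (U ++ v ^ʷ suc n)
  U++vⁿ-not-ins-robust n (_ , insertions-primitive) =
    proj₂ (insertions-primitive (length u₁) u₁≤w c) (v , suc (suc n) , s≤s (s≤s z≤n) , inserted)
    where
    open ≡-Reasoning
    V : Word k
    V = v ^ʷ suc n
    u₁≤w : length u₁ ≤ length (U ++ V)
    u₁≤w = subst (length u₁ ≤_) (cong length (sym (++-assoc u₁ u₂ V))) (length-++-≤ˡ u₁)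
    inserted : insertAt (length u₁) c (U ++ V) ≡ v ^ʷ suc (suc n)
    inserted = begin
      insertAt (length u₁) c (U ++ V)           ≡⟨ cong (insertAt (length u₁) c) (++-assoc u₁ u₂ V) ⟩
      insertAt (length u₁) c (u₁ ++ (u₂ ++ V))  ≡⟨ cong₂ (λ xs ys → xs ++ c ∷ ys) (take-length-++ u₁ _ refl)
                                                                                 (drop-length-++ u₁ _ refl) ⟩
      u₁ ++ c ∷ (u₂ ++ V)                       ≡⟨ sym (++-assoc u₁ (c ∷ u₂) V) ⟩
      v ++ V                                    ∎

proposition8 : (k : ℕ) → 2 ≤ k → (u v : Word k) → Primitive u → Primitive v
    → (m n : ℕ) → 2 ≤ m → 2 ≤ n
    → (u₁ u₂ : Word k) (c : Fin k)
    → u ^ʷ m ≡ u₁ ++ u₂ → v ≡ u₁ ++ ([ c ] ++ u₂)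
    → PrimNotInsRobust ((u ^ʷ m) ++ (v ^ʷ n))
proposition8 k _ u _ (u≢[] , _) pv (suc (suc m)) (suc (suc n)) (s≤s (s≤s _)) (s≤s (s≤s _)) u₁ u₂ c uᵐ≡U refl =
  subst (λ w → PrimNotInsRobust (w ++ v ^ʷ suc (suc n))) (sym uᵐ≡U)
    (U++vⁿ-primitive pv 0<|U| n , U++vⁿ-not-ins-robust (suc n))
  where
  open Insertion u₁ u₂ c
  0<|U| : 0 < length U
  0<|U| = subst (λ w → 0 < length w) uᵐ≡U (0<length-^ʷ u (suc m) u≢[])
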